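{- Let $d\ge1$ and $r\ge 3d+3$ be integers. If $v_1,\dots,v_{d+1}$ are vertices of the Kostka polytope $P_r$ with labels $(a_i,b_i,\ell_i)$ such that the closed intervals $[\ell_i,a_i]$, $1\le i\le d+1$, are pairwise disjoint, then $\{v_1,\dots,v_{d+1}\}$ is the vertex set of a $d$-dimensional face of $P_r$.
   Context: For a positive integer $r$, a partition with at most $r$ parts is written as a non-increasing $r$-tuple of nonnegative integers; $\mathrm{Par}_r(n)$ is the set of those with entries summing to $n$. For $\lambda,\mu\in\mathrm{Par}_r(n)$, $\lambda$ dominates $\mu$ if $\sum_{i=1}^k\lambda_i\ge\sum_{i=1}^k\mu_i$ for all $k\le r$. The $r$-Kostka cone $\mathcal{K}_r\subseteq\mathbb{R}^{2r}$ is the convex hull of all points $(\lambda_1,\dots,\lambda_r,\mu_1,\dots,\mu_r)$ with $\lambda,\mu\in\mathrm{Par}_r(n)$ for some $n$ and $\lambda$ dominating $\mu$. The Kostka polytope $P_r$ is $\mathcal{K}_r\cap\{x:\sum_{i=1}^r(\lambda_i+\mu_i)=1\}$, whose vertices are the intersections with the extremal rays of $\mathcal{K}_r$. It is known that the extremal rays of $\mathcal{K}_r$ are exactly the rays spanned by the vectors $\big((a-\ell)^b,0^{r-b};\,(a-\ell)^\ell,(b-\ell)^{a-\ell},0^{r-a}\big)$ for integers $0\le\ell<b\le a\le r$, where exponents denote repetition of an entry. A vertex of $P_r$ on the ray of such a vector with $a\neq b$ (so $0\le\ell<b<a\le r$) is labeled $(a,b,\ell)$; when $a=b$ the ray does not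 depend on $\ell$, and the vertex is labeled $(a,a,a)$. -}

module Defs where

open import Data.Nat using (ℕ; zero; suc; _+_; _*_; _∸_; _≤_; _<_; _<ᵇ_; _≡ᵇ_)
open import Data.Bool using (if_then_else_)
open import Data.Fin using (Fin; toℕ) renaming (zero to fzero; suc to fsuc)
open import Data.Integer as ℤ using (ℤ; +_)
open import Data.Product using (Σ; _×_; ∃)
open import Data.Sum using (_⊎_)
open import Relation.Binary.PropositionalEquality using (_≡_)

-- r-tuples of naturals / integers are functions Fin r → _
-- psum f k = f 0 + ... + f (k-1)   (all r entries if k ≥ r)
psum : {r : ℕ} → (Fin r → ℕ) → ℕ → ℕ
psum {zero}  f k       = 0
psum {suc r} f zero    = 0
psum {suc r} f (suc k) = f fzero + psum (λ i → f (fsuc i)) k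

total : {r : ℕ} → (Fin r → ℕ) → ℕ
total {r} f = psum f r

IsPartition : (r : ℕ) → (Fin r → ℕ) → Set
IsPartition r la = ∀ (i j : Fin r) → toℕ i ≤ toℕ j → la j ≤ la i

Dominates : (r : ℕ) → (Fin r → ℕ) → (Fin r → ℕ) → Set
Dominates r la mu = total la ≡ total mu × (∀ k → k ≤ r → psum mu k ≤ psum la k)

Σℤ : {r : ℕ} → (Fin r → ℤ) → ℤ
Σℤ {zero}  f = + 0
Σℤ {suc r} f = f fzero ℤ.+ Σℤ (λ i → f (fsuc i))

dot : {r : ℕ} → (Fin r → ℤ) → (Fin r → ℤ) → (Fin r → ℕ) → (Fin r → ℕ) → ℤ
dot cλ cμ la mu = Σℤ (λ i → cλ i ℤ.* (+ la i)) ℤ.+ Σℤ (λ i → cμ i ℤ.* (+ mu i))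

-- the vector ((a-ℓ)^b,0^{r-b}; (a-ℓ)^ℓ,(b-ℓ)^{a-ℓ},0^{r-a})
genλ : (r a b ℓ : ℕ) → Fin r → ℕ
genλ r a b ℓ i = if toℕ i <ᵇ b then a ∸ ℓ else 0

genμ : (r a b ℓ : ℕ) → Fin r → ℕ
genμ r a b ℓ i = if toℕ i <ᵇ ℓ then a ∸ ℓ else (if toℕ i <ᵇ a then b ∸ ℓ else 0)

record Label : Set where
  constructor lab
  field
    a b ℓ : ℕ
open Label public

ValidLabel : ℕ → Label → Set
ValidLabel r L = (ℓ L < b L × b L < a L × a L ≤ r)
               ⊎ (a L ≡ b L × b L ≡ ℓ L × 1 ≤ a L × a L ≤ r)

-- a spanning vector of the extremal ray of K_r carrying the vertex labelled L
-- (for the label (a,a,a) the ray does not depend on ℓ; we use ℓ = 0)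
rayλ : (r : ℕ) → Label → Fin r → ℕ
rayλ r (lab a b ℓ) = if a ≡ᵇ b then genλ r a a 0 else genλ r a b ℓ

rayμ : (r : ℕ) → Label → Fin r → ℕ
rayμ r (lab a b ℓ) = if a ≡ᵇ b then genμ r a a 0 else genμ r a b ℓ

-- size of the ray vector: the vertex of P_r is ray / raySize
raySize : (r : ℕ) → Label → ℕ
raySize r L = total (rayλ r L) + total (rayμ r L)

SameVertex : (r : ℕ) → Label → Label → Set
SameVertex r L M =
  (∀ i → raySize r M * rayλ r L i ≡ raySize r L * rayλ r M i) ×
  (∀ i → raySize r M * rayμ r L i ≡ raySize r L * rayμ r M i)

-- the vertices labelled L 0, …, L d are affinely independent;
-- since they lie on the hyperplane Σ x = 1, this is linear independence of
-- the vertices, equivalently of the (positively rescaled) ray vectors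
-- (integer coefficients suffice by clearing denominators)
AffIndep : (r d : ℕ) → (Fin (suc d) → Label) → Set
AffIndep r d L =
  (t : Fin (suc d) → ℤ) →
  (∀ k → Σℤ (λ i → t i ℤ.* (+ rayλ r (L i) k)) ≡ + 0) →
  (∀ k → Σℤ (λ i → t i ℤ.* (+ rayμ r (L i) k)) ≡ + 0) →
  ∀ i → t i ≡ + 0

-- {v_L i} is the vertex set of a d-dimensional face of P_r:
-- some linear functional c is ≥ 0 on the cone K_r (i.e. on all generating
-- points (λ,μ) with λ dominating μ), the face P_r ∩ {c = 0} has as vertices
-- exactly the vertices labelled L i, and these are affinely independent
-- (so the face is a d-simplex, of dimension d).
IsVertexSetOfDFace : (r d : ℕ) → (Fin (suc d) → Label) → Set
IsVertexSetOfDFace r d L =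
  Σ (Fin r → ℤ) λ cλ → Σ (Fin r → ℤ) λ cμ →
    (∀ (la mu : Fin r → ℕ) → IsPartition r la → IsPartition r mu →
       Dominates r la mu → + 0 ℤ.≤ dot cλ cμ la mu)
  × (∀ M → ValidLabel r M →
       (dot cλ cμ (rayλ r M) (rayμ r M) ≡ + 0 → ∃ λ i → SameVertex r M (L i))
     × ((∃ λ i → SameVertex r M (L i)) → dot cλ cμ (rayλ r M) (rayμ r M) ≡ + 0))
  × AffIndep r d L

{-# OPTIONS --safe #-}
-- The Kostka cone is cut out by the facet inequalities
-- λ_p ≥ λ_(p+1), μ_p ≥ μ_(p+1) and λ_1 + ⋯ + λ_k ≥ μ_1 + ⋯ + μ_k.  Summing the
-- facet forms that vanish on all the rays L 0, …, L d gives a form that is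
-- nonnegative on the cone, vanishes on these rays, and vanishes at a point of
-- the cone only if every facet inequality that is strict there is strict on
-- some L i.  On the ray of a label (a, b, ℓ) exactly three kinds of facet
-- inequalities are strict: the λ-drop at b, the μ-drops at ℓ and a, and the
-- dominance inequalities for ℓ < k < a.  When the intervals [ℓ_i, a_i] are
-- pairwise disjoint, a label all of whose strict inequalities are strict on
-- some L i is one of the L i: a dominance inequality puts ℓ + 1 in some
-- interval [ℓ_i, a_i], and the drops then force (a, b, ℓ) = (a_i, b_i, ℓ_i).
-- Finally, the μ-drop at a_i is strict on L i and on no other L j, so the rays
-- are linearly independent and the face is a d-simplex.

module Submission where

open import Defs
open import Data.Nat using (ℕ; zero; suc; pred; _+_; _*_; _∸_; _⊓_; _≤_; _<_; z≤n; s≤s; _<ᵇ_; _≡ᵇ_; >-nonZero)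
open import Data.Bool using (true; false; if_then_else_)
open import Data.Fin using (Fin; toℕ; fromℕ<) renaming (zero to fzero; suc to fsuc)
open import Data.Fin.Properties using (all?; ¬∀⟶∃¬; suc-injective; toℕ<n; toℕ-fromℕ<)
open import Data.Integer as ℤ using (ℤ; +_; -_; 0ℤ; +≤+)
import Data.Integer.Properties as ℤₚ
import Data.Integer.Tactic.RingSolver as ℤ-Solver
import Data.Nat.Properties as ℕₚ
import Data.Nat.Tactic.RingSolver as ℕ-Solver
open import Data.Product using (_×_; _,_; proj₁; proj₂; ∃; map₂)
open import Function.Bundles using (_⇔_; mk⇔; Equivalence)
open Equivalence using (to; from)
open import Function.Properties.Equivalence using () renaming (refl to ⇔-refl)
open import Data.Sum using (_⊎_; inj₁; inj₂)
open import Data.Empty using (⊥-elim)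
open import Function using (_∘_)
open import Relation.Nullary using (Dec; yes; no; ¬_)
open import Relation.Nullary.Reflects using (ofʸ; ofⁿ)
open import Relation.Binary using (tri<; tri≈; tri>)
open import Relation.Binary.PropositionalEquality
open import Algebra.Properties.Semiring.Sum ℤₚ.+-*-semiring
  using (sum; sum-cong-≗; ∑-distrib-+; ∑-comm; *-distribˡ-sum; *-distribʳ-sum; sum-replicate-zero)

Σℤ≡sum : ∀ {n} (f : Fin n → ℤ) → Σℤ f ≡ sum f
Σℤ≡sum {zero}  f = refl
Σℤ≡sum {suc n} f = cong (λ s → f fzero ℤ.+ s) (Σℤ≡sum (f ∘ fsuc))

sum-cong : ∀ {n} {f g : Fin n → ℤ} → (∀ i → f i ≡ g i) → sum f ≡ sum g
sum-cong {n} = sum-cong-≗ {n}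

sum-zero : ∀ {n} {f : Fin n → ℤ} → (∀ i → f i ≡ 0ℤ) → sum f ≡ 0ℤ
sum-zero {n} f≡0 = trans (sum-cong f≡0) (sum-replicate-zero n)

sum-nonneg : ∀ {n} {f : Fin n → ℤ} → (∀ i → 0ℤ ℤ.≤ f i) → 0ℤ ℤ.≤ sum f
sum-nonneg {zero}  _   = ℤₚ.≤-refl
sum-nonneg {suc n} f≥0 = ℤₚ.+-mono-≤ (f≥0 fzero) (sum-nonneg (f≥0 ∘ fsuc))

nonneg-+-≡0 : ∀ {i j} → 0ℤ ℤ.≤ i → 0ℤ ℤ.≤ j → i ℤ.+ j ≡ 0ℤ → i ≡ 0ℤ × j ≡ 0ℤ
nonneg-+-≡0 {+ m} {+ n} _ _ m+n≡0 with ℕₚ.m+n≡0⇒m≡0 m (ℤₚ.+-injective m+n≡0)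
... | refl = refl , m+n≡0

sum-nonneg-≡0 : ∀ {n} {f : Fin n → ℤ} → (∀ i → 0ℤ ℤ.≤ f i) → sum f ≡ 0ℤ → ∀ i → f i ≡ 0ℤ
sum-nonneg-≡0 {suc n} f≥0 Σf≡0 i with nonneg-+-≡0 (f≥0 fzero) (sum-nonneg (f≥0 ∘ fsuc)) Σf≡0
sum-nonneg-≡0 {suc n} f≥0 Σf≡0 fzero    | f₀≡0 , _    = f₀≡0
sum-nonneg-≡0 {suc n} f≥0 Σf≡0 (fsuc i) | _    , rest = sum-nonneg-≡0 (f≥0 ∘ fsuc) rest i

sum-single : ∀ {n} {f : Fin n → ℤ} i → (∀ j → j ≢ i → f j ≡ 0ℤ) → sum f ≡ f i
sum-single {suc n} {f} fzero    others =
  trans (cong (λ s → f fzero ℤ.+ s) (sum-zero (λ j → others (fsuc j) λ ())))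
        (ℤₚ.+-identityʳ (f fzero))
sum-single {suc n} {f} (fsuc i) others =
  trans (cong (λ s → s ℤ.+ sum (f ∘ fsuc)) (others fzero λ ()))
        (trans (ℤₚ.+-identityˡ _)
               (sum-single i (λ j j≢i → others (fsuc j) (j≢i ∘ suc-injective))))

sum-swap-weighted : ∀ {m n} (w : Fin m → ℤ) (A : Fin m → Fin n → ℤ) (c : Fin n → ℤ) →
  sum (λ q → w q ℤ.* sum (λ i → A q i ℤ.* c i)) ≡ sum (λ i → sum (λ q → w q ℤ.* A q i) ℤ.* c i)
sum-swap-weighted w A c = begin
  sum (λ q → w q ℤ.* sum (λ i → A q i ℤ.* c i))
    ≡⟨ sum-cong (λ q → *-distribˡ-sum (w q) (λ i → A q i ℤ.* c i)) ⟩
  sum (λ q → sum (λ i → w q ℤ.* (A q i ℤ.* c i)))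
    ≡⟨ ∑-comm (λ q i → w q ℤ.* (A q i ℤ.* c i)) ⟩
  sum (λ i → sum (λ q → w q ℤ.* (A q i ℤ.* c i)))
    ≡⟨ sum-cong (λ i → sum-cong (λ q → sym (ℤₚ.*-assoc (w q) (A q i) (c i)))) ⟩
  sum (λ i → sum (λ q → w q ℤ.* A q i ℤ.* c i))
    ≡⟨ sum-cong (λ i → sym (*-distribʳ-sum (c i) (λ q → w q ℤ.* A q i))) ⟩
  sum (λ i → sum (λ q → w q ℤ.* A q i) ℤ.* c i)
    ∎
  where open ≡-Reasoning

i*j≡0⇒j≡0 : ∀ i {j} → i ≢ 0ℤ → i ℤ.* j ≡ 0ℤ → j ≡ 0ℤ
i*j≡0⇒j≡0 i i≢0 ij≡0 with ℤₚ.i*j≡0⇒i≡0∨j≡0 i ij≡0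
... | inj₁ i≡0 = ⊥-elim (i≢0 i≡0)
... | inj₂ j≡0 = j≡0

[+m]-[+n]≢0⇔m≢n : ∀ {m n} → (+ m ℤ.- + n ≢ 0ℤ) ⇔ (m ≢ n)
[+m]-[+n]≢0⇔m≢n {m} {n} = mk⇔
  (λ m-n≢0 m≡n → m-n≢0 (ℤₚ.i≡j⇒i-j≡0 (cong +_ m≡n)))
  (λ m≢n m-n≡0 → m≢n (ℤₚ.+-injective (ℤₚ.i-j≡0⇒i≡j (+ m) (+ n) m-n≡0)))

infix 8 _·_
_·_ : ∀ {r} → (Fin r → ℤ) → (Fin r → ℕ) → ℤ
c · x = sum (λ i → c i ℤ.* + x i)

·-cong : ∀ {r} (c : Fin r → ℤ) {x y : Fin r → ℕ} → (∀ i → x i ≡ y i) → c · x ≡ c · y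
·-cong c x≗y = sum-cong (λ i → cong (λ n → c i ℤ.* + n) (x≗y i))

·-zero : ∀ {r} (x : Fin r → ℕ) → (λ _ → 0ℤ) · x ≡ 0ℤ
·-zero {r} x = sum-zero {r} (λ _ → refl)

·-+ : ∀ {r} (c d : Fin r → ℤ) (x : Fin r → ℕ) → (λ i → c i ℤ.+ d i) · x ≡ c · x ℤ.+ d · x
·-+ {r} c d x = trans (sum-cong {r} (λ i → ℤₚ.*-distribʳ-+ (+ x i) (c i) (d i)))
                       (∑-distrib-+ (λ i → c i ℤ.* + x i) (λ i → d i ℤ.* + x i))

·-neg : ∀ {r} (c : Fin r → ℤ) (x : Fin r → ℕ) → (λ i → - c i) · x ≡ - (c · x)
·-neg c x = begin
  sum (λ i → - c i ℤ.* + x i)          ≡⟨ sum-cong (λ i → sym (ℤₚ.neg-distribˡ-* (c i) (+ x i))) ⟩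
  sum (λ i → - (c i ℤ.* + x i))        ≡⟨ sum-cong (λ i → sym (ℤₚ.-1*i≡-i (c i ℤ.* + x i))) ⟩
  sum (λ i → - + 1 ℤ.* (c i ℤ.* + x i)) ≡⟨ sym (*-distribˡ-sum (- + 1) (λ i → c i ℤ.* + x i)) ⟩
  - + 1 ℤ.* (c · x)                    ≡⟨ ℤₚ.-1*i≡-i (c · x) ⟩
  - (c · x)                            ∎
  where open ≡-Reasoning

·-scale : ∀ {r} (c : Fin r → ℤ) s (x : Fin r → ℕ) → c · (λ i → s * x i) ≡ + s ℤ.* (c · x)
·-scale c s x = trans (sum-cong (λ i → trans (cong (c i ℤ.*_) (ℤₚ.pos-* s (x i))) (swap (c i) (+ s) (+ x i))))
                      (sym (*-distribˡ-sum (+ s) (λ i → c i ℤ.* + x i)))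
  where
  swap : ∀ u v w → u ℤ.* (v ℤ.* w) ≡ v ℤ.* (u ℤ.* w)
  swap = ℤ-Solver.solve-∀

·-weighted-sum : ∀ {m r} (w : Fin m → ℤ) (c : Fin m → Fin r → ℤ) (x : Fin r → ℕ) →
  (λ i → sum (λ q → w q ℤ.* c q i)) · x ≡ sum (λ q → w q ℤ.* (c q · x))
·-weighted-sum w c x = sym (sum-swap-weighted w c (λ i → + x i))

record Form (r : ℕ) : Set where
  constructor form
  field
    onλ onμ : Fin r → ℤ
open Form

eval : ∀ {r} → Form r → (Fin r → ℕ) → (Fin r → ℕ) → ℤ
eval φ x y = onλ φ · x ℤ.+ onμ φ · y

dot≡eval : ∀ {r} (φ : Form r) x y → dot (onλ φ) (onμ φ) x y ≡ eval φ x y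
dot≡eval φ x y = cong₂ ℤ._+_ (Σℤ≡sum (λ i → onλ φ i ℤ.* + x i)) (Σℤ≡sum (λ i → onμ φ i ℤ.* + y i))

infixl 6 _⊕_
_⊕_ : ∀ {r} → Form r → Form r → Form r
φ ⊕ ψ = form (λ i → onλ φ i ℤ.+ onλ ψ i) (λ i → onμ φ i ℤ.+ onμ ψ i)

eval-⊕ : ∀ {r} (φ ψ : Form r) x y → eval (φ ⊕ ψ) x y ≡ eval φ x y ℤ.+ eval ψ x y
eval-⊕ φ ψ x y = trans (cong₂ ℤ._+_ (·-+ (onλ φ) (onλ ψ) x) (·-+ (onμ φ) (onμ ψ) y))
                       (middle-swap (onλ φ · x) (onλ ψ · x) (onμ φ · y) (onμ ψ · y))
  where
  middle-swap : ∀ a b c d → (a ℤ.+ b) ℤ.+ (c ℤ.+ d) ≡ (a ℤ.+ c) ℤ.+ (b ℤ.+ d)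
  middle-swap = ℤ-Solver.solve-∀

weightedSum : ∀ {m r} → (Fin m → ℤ) → (Fin m → Form r) → Form r
weightedSum w φ = form (λ i → sum (λ q → w q ℤ.* onλ (φ q) i)) (λ i → sum (λ q → w q ℤ.* onμ (φ q) i))

eval-weightedSum : ∀ {m r} (w : Fin m → ℤ) (φ : Fin m → Form r) x y →
  eval (weightedSum w φ) x y ≡ sum (λ q → w q ℤ.* eval (φ q) x y)
eval-weightedSum w φ x y = begin
  eval (weightedSum w φ) x y
    ≡⟨ cong₂ ℤ._+_ (·-weighted-sum w (onλ ∘ φ) x) (·-weighted-sum w (onμ ∘ φ) y) ⟩
  sum (λ q → w q ℤ.* (onλ (φ q) · x)) ℤ.+ sum (λ q → w q ℤ.* (onμ (φ q) · y))
    ≡⟨ sym (∑-distrib-+ (λ q → w q ℤ.* (onλ (φ q) · x)) (λ q → w q ℤ.* (onμ (φ q) · y))) ⟩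
  sum (λ q → w q ℤ.* (onλ (φ q) · x) ℤ.+ w q ℤ.* (onμ (φ q) · y))
    ≡⟨ sum-cong (λ q → sym (ℤₚ.*-distribˡ-+ (w q) _ _)) ⟩
  sum (λ q → w q ℤ.* eval (φ q) x y) ∎
  where open ≡-Reasoning

eval-cong : ∀ {r} (φ : Form r) {x x′ y y′ : Fin r → ℕ} →
  (∀ i → x i ≡ x′ i) → (∀ i → y i ≡ y′ i) → eval φ x y ≡ eval φ x′ y′
eval-cong φ x≗x′ y≗y′ = cong₂ ℤ._+_ (·-cong (onλ φ) x≗x′) (·-cong (onμ φ) y≗y′)

eval-scale : ∀ {r} (φ : Form r) s x y → eval φ (λ i → s * x i) (λ i → s * y i) ≡ + s ℤ.* eval φ x y
eval-scale φ s x y = trans (cong₂ ℤ._+_ (·-scale (onλ φ) s x) (·-scale (onμ φ) s y))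
                           (sym (ℤₚ.*-distribˡ-+ (+ s) (onλ φ · x) (onμ φ · y)))

vanishes-proportional : ∀ {r} (φ : Form r) {x y x′ y′ : Fin r → ℕ} s t → 1 ≤ s →
  (∀ i → s * x i ≡ t * x′ i) → (∀ i → s * y i ≡ t * y′ i) →
  eval φ x′ y′ ≡ 0ℤ → eval φ x y ≡ 0ℤ
vanishes-proportional φ {x} {y} {x′} {y′} s t 1≤s sx≡tx′ sy≡ty′ φx′y′≡0 =
  i*j≡0⇒j≡0 (+ s) (λ s≡0 → ℕₚ.<⇒≢ 1≤s (sym (ℤₚ.+-injective s≡0))) (begin
    + s ℤ.* eval φ x y                         ≡⟨ sym (eval-scale φ s x y) ⟩
    eval φ (λ i → s * x i) (λ i → s * y i)     ≡⟨ eval-cong φ sx≡tx′ sy≡ty′ ⟩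
    eval φ (λ i → t * x′ i) (λ i → t * y′ i)   ≡⟨ eval-scale φ t x′ y′ ⟩
    + t ℤ.* eval φ x′ y′                       ≡⟨ cong (+ t ℤ.*_) φx′y′≡0 ⟩
    + t ℤ.* 0ℤ                                 ≡⟨ ℤₚ.*-zeroʳ (+ t) ⟩
    0ℤ                                         ∎)
  where open ≡-Reasoning

-- The face of a cone spanned by finitely many points

module SpannedFace {r m k : ℕ}
  (InCone : (Fin r → ℕ) → (Fin r → ℕ) → Set)
  (facet : Fin m → Form r)
  (facet-nonneg : ∀ q {x y} → InCone x y → 0ℤ ℤ.≤ eval (facet q) x y)
  (xs ys : Fin k → Fin r → ℕ)
  where

  Tight : Fin m → Set
  Tight q = ∀ j → eval (facet q) (xs j) (ys j) ≡ 0ℤ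

  tight? : ∀ q → Dec (Tight q)
  tight? q = all? (λ j → eval (facet q) (xs j) (ys j) ℤ.≟ 0ℤ)

  weight : Fin m → ℤ
  weight q with tight? q
  ... | yes _ = + 1
  ... | no  _ = 0ℤ

  face : Form r
  face = weightedSum weight facet

  private
    weighted-nonneg : ∀ {x y} → InCone x y → ∀ q → 0ℤ ℤ.≤ weight q ℤ.* eval (facet q) x y
    weighted-nonneg x∈ q with tight? q
    ... | yes _ = subst (0ℤ ℤ.≤_) (sym (ℤₚ.*-identityˡ _)) (facet-nonneg q x∈)
    ... | no  _ = ℤₚ.≤-refl

    weighted-vanishes : ∀ j q → weight q ℤ.* eval (facet q) (xs j) (ys j) ≡ 0ℤ
    weighted-vanishes j q with tight? q
    ... | yes tight = trans (ℤₚ.*-identityˡ _) (tight j)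
    ... | no  _     = refl

    weighted-≡0 : ∀ q {v} → weight q ℤ.* v ≡ 0ℤ → v ≢ 0ℤ → ¬ Tight q
    weighted-≡0 q {v} wv≡0 v≢0 with tight? q
    ... | yes _     = λ _ → v≢0 (trans (sym (ℤₚ.*-identityˡ v)) wv≡0)
    ... | no  ¬tight = ¬tight

  face-nonneg : ∀ {x y} → InCone x y → 0ℤ ℤ.≤ eval face x y
  face-nonneg {x} {y} x∈ =
    subst (0ℤ ℤ.≤_) (sym (eval-weightedSum weight facet x y)) (sum-nonneg (weighted-nonneg x∈))

  face-vanishes : ∀ j → eval face (xs j) (ys j) ≡ 0ℤ
  face-vanishes j = trans (eval-weightedSum weight facet (xs j) (ys j)) (sum-zero (weighted-vanishes j))

  face-covers : ∀ {x y} → InCone x y → eval face x y ≡ 0ℤ →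
    ∀ q → eval (facet q) x y ≢ 0ℤ → ∃ λ j → eval (facet q) (xs j) (ys j) ≢ 0ℤ
  face-covers {x} {y} x∈ face≡0 q φq≢0 =
    ¬∀⟶∃¬ k _ (λ j → eval (facet q) (xs j) (ys j) ℤ.≟ 0ℤ)
      (weighted-≡0 q (sum-nonneg-≡0 (weighted-nonneg x∈)
                       (trans (sym (eval-weightedSum weight facet x y)) face≡0) q) φq≢0)

-- Facets of the Kostka cone

Kostka : ∀ r → (Fin r → ℕ) → (Fin r → ℕ) → Set
Kostka r x y = IsPartition r x × IsPartition r y × Dominates r x y

∀Fin⇒∀< : ∀ {r} {P : ℕ → Set} → (∀ (p : Fin r) → P (toℕ p)) → ∀ n → n < r → P n
∀Fin⇒∀< {P = P} h n n<r = subst P (toℕ-fromℕ< n<r) (h (fromℕ< n<r))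

-- Entries past the end read as 0, so the last drop inequality is x (r - 1) ≥ 0.
entry : ∀ {r} → (Fin r → ℕ) → ℕ → ℕ
entry {zero}  x n       = 0
entry {suc r} x zero    = x fzero
entry {suc r} x (suc n) = entry (x ∘ fsuc) n

entry-≗ : ∀ {r} {x : Fin r → ℕ} (g : ℕ → ℕ) → (∀ i → x i ≡ g (toℕ i)) →
  (∀ n → r ≤ n → g n ≡ 0) → ∀ n → entry x n ≡ g n
entry-≗ {zero}  g x≗g g≡0 n       = sym (g≡0 n z≤n)
entry-≗ {suc r} g x≗g g≡0 zero    = x≗g fzero
entry-≗ {suc r} g x≗g g≡0 (suc n) =
  entry-≗ (g ∘ suc) (x≗g ∘ fsuc) (λ m r≤m → g≡0 (suc m) (s≤s r≤m)) n

entry-antitone : ∀ {r} {x : Fin r → ℕ} → IsPartition r x → ∀ n → entry x (suc n) ≤ entry x n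
entry-antitone {zero}        x↓ n       = z≤n
entry-antitone {suc zero}    x↓ zero    = z≤n
entry-antitone {suc (suc r)} x↓ zero    = x↓ fzero (fsuc fzero) z≤n
entry-antitone {suc r}       x↓ (suc n) =
  entry-antitone {r} (λ i j i≤j → x↓ (fsuc i) (fsuc j) (s≤s i≤j)) n

DropsAt : (ℕ → ℕ) → ℕ → Set
DropsAt f n = f n ≢ f (suc n)

Drop : ∀ {r} → (Fin r → ℕ) → ℕ → Set
Drop x = DropsAt (entry x)

Excess : ∀ {r} → (Fin r → ℕ) → (Fin r → ℕ) → ℕ → Set
Excess x y k = psum x k ≢ psum y k

unit : ∀ {r} → ℕ → Fin r → ℤ
unit n i = if toℕ i ≡ᵇ n then + 1 else 0ℤ

unit-· : ∀ {r} n (x : Fin r → ℕ) → unit n · x ≡ + entry x n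
unit-· {zero}  n       x = refl
unit-· {suc r} zero    x =
  trans (cong₂ ℤ._+_ (ℤₚ.*-identityˡ (+ x fzero)) (sum-zero {r} (λ _ → refl)))
        (ℤₚ.+-identityʳ (+ x fzero))
unit-· {suc r} (suc n) x = trans (ℤₚ.+-identityˡ _) (unit-· n (x ∘ fsuc))

prefix : ∀ {r} → ℕ → Fin r → ℤ
prefix k i = if toℕ i <ᵇ k then + 1 else 0ℤ

prefix-· : ∀ {r} k (x : Fin r → ℕ) → prefix k · x ≡ + psum x k
prefix-· {zero}  k       x = refl
prefix-· {suc r} zero    x = sum-zero {suc r} (λ _ → refl)
prefix-· {suc r} (suc k) x = cong₂ ℤ._+_ (ℤₚ.*-identityˡ (+ x fzero)) (prefix-· k (x ∘ fsuc))

dropCoeffs : ∀ {r} → ℕ → Fin r → ℤ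
dropCoeffs n i = unit n i ℤ.- unit (suc n) i

dropCoeffs-· : ∀ {r} n (x : Fin r → ℕ) → dropCoeffs n · x ≡ + entry x n ℤ.- + entry x (suc n)
dropCoeffs-· n x = trans (·-+ (unit n) (λ i → - unit (suc n) i) x)
  (cong₂ ℤ._+_ (unit-· n x) (trans (·-neg (unit (suc n)) x) (cong -_ (unit-· (suc n) x))))

dropCoeffs-·≢0⇔ : ∀ {r} n (x : Fin r → ℕ) → (dropCoeffs n · x ≢ 0ℤ) ⇔ Drop x n
dropCoeffs-·≢0⇔ n x = subst (λ v → (v ≢ 0ℤ) ⇔ Drop x n) (sym (dropCoeffs-· n x)) [+m]-[+n]≢0⇔m≢n

λ-drop μ-drop dominance : ∀ {r} → Fin r → Form r
λ-drop    p = form (dropCoeffs (toℕ p)) (λ _ → 0ℤ)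
μ-drop    p = form (λ _ → 0ℤ) (dropCoeffs (toℕ p))
dominance p = form (prefix (suc (toℕ p))) (λ i → - prefix (suc (toℕ p)) i)

eval-λ-drop : ∀ {r} (p : Fin r) x y → eval (λ-drop p) x y ≡ + entry x (toℕ p) ℤ.- + entry x (suc (toℕ p))
eval-λ-drop p x y = trans (cong₂ ℤ._+_ (dropCoeffs-· (toℕ p) x) (·-zero y)) (ℤₚ.+-identityʳ _)

eval-μ-drop : ∀ {r} (p : Fin r) x y → eval (μ-drop p) x y ≡ + entry y (toℕ p) ℤ.- + entry y (suc (toℕ p))
eval-μ-drop p x y = trans (cong₂ ℤ._+_ (·-zero x) (dropCoeffs-· (toℕ p) y)) (ℤₚ.+-identityˡ _)

eval-dominance : ∀ {r} (p : Fin r) x y → eval (dominance p) x y ≡ + psum x (suc (toℕ p)) ℤ.- + psum y (suc (toℕ p))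
eval-dominance p x y = cong₂ ℤ._+_ (prefix-· (suc (toℕ p)) x)
  (trans (·-neg (prefix (suc (toℕ p))) y) (cong -_ (prefix-· (suc (toℕ p)) y)))

λ-drop-nonneg : ∀ {r} (p : Fin r) {x y} → Kostka r x y → 0ℤ ℤ.≤ eval (λ-drop p) x y
λ-drop-nonneg p {x} {y} (x↓ , _ , _) =
  subst (0ℤ ℤ.≤_) (sym (eval-λ-drop p x y)) (ℤₚ.i≤j⇒0≤j-i (+≤+ (entry-antitone x↓ (toℕ p))))

μ-drop-nonneg : ∀ {r} (p : Fin r) {x y} → Kostka r x y → 0ℤ ℤ.≤ eval (μ-drop p) x y
μ-drop-nonneg p {x} {y} (_ , y↓ , _) =
  subst (0ℤ ℤ.≤_) (sym (eval-μ-drop p x y)) (ℤₚ.i≤j⇒0≤j-i (+≤+ (entry-antitone y↓ (toℕ p))))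

dominance-nonneg : ∀ {r} (p : Fin r) {x y} → Kostka r x y → 0ℤ ℤ.≤ eval (dominance p) x y
dominance-nonneg p {x} {y} (_ , _ , _ , x≽y) =
  subst (0ℤ ℤ.≤_) (sym (eval-dominance p x y)) (ℤₚ.i≤j⇒0≤j-i (+≤+ (x≽y (suc (toℕ p)) (toℕ<n p))))

λ-drop≢0⇔ : ∀ {r} (p : Fin r) x y → (eval (λ-drop p) x y ≢ 0ℤ) ⇔ Drop x (toℕ p)
λ-drop≢0⇔ p x y = subst (λ v → (v ≢ 0ℤ) ⇔ Drop x (toℕ p)) (sym (eval-λ-drop p x y)) [+m]-[+n]≢0⇔m≢n

μ-drop≢0⇔ : ∀ {r} (p : Fin r) x y → (eval (μ-drop p) x y ≢ 0ℤ) ⇔ Drop y (toℕ p)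
μ-drop≢0⇔ p x y = subst (λ v → (v ≢ 0ℤ) ⇔ Drop y (toℕ p)) (sym (eval-μ-drop p x y)) [+m]-[+n]≢0⇔m≢n

dominance≢0⇔ : ∀ {r} (p : Fin r) x y → (eval (dominance p) x y ≢ 0ℤ) ⇔ Excess x y (suc (toℕ p))
dominance≢0⇔ p x y =
  subst (λ v → (v ≢ 0ℤ) ⇔ Excess x y (suc (toℕ p))) (sym (eval-dominance p x y)) [+m]-[+n]≢0⇔m≢n

record InFaceSpannedBy {r k} (x y : Fin r → ℕ) (xs ys : Fin k → Fin r → ℕ) : Set where
  field
    λ-drops  : ∀ n → n < r → Drop x n → ∃ λ j → Drop (xs j) n
    μ-drops  : ∀ n → n < r → Drop y n → ∃ λ j → Drop (ys j) n
    excesses : ∀ n → n < r → Excess x y (suc n) → ∃ λ j → Excess (xs j) (ys j) (suc n)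

module KostkaFace {r k : ℕ} (xs ys : Fin k → Fin r → ℕ) where
  private
    module Fλ = SpannedFace (Kostka r) λ-drop    λ-drop-nonneg    xs ys
    module Fμ = SpannedFace (Kostka r) μ-drop    μ-drop-nonneg    xs ys
    module Fd = SpannedFace (Kostka r) dominance dominance-nonneg xs ys

  face : Form r
  face = Fλ.face ⊕ Fμ.face ⊕ Fd.face

  eval-face : ∀ x y → eval face x y ≡ eval Fλ.face x y ℤ.+ eval Fμ.face x y ℤ.+ eval Fd.face x y
  eval-face x y = trans (eval-⊕ (Fλ.face ⊕ Fμ.face) Fd.face x y)
                        (cong (ℤ._+ eval Fd.face x y) (eval-⊕ Fλ.face Fμ.face x y))

  face-nonneg : ∀ {x y} → Kostka r x y → 0ℤ ℤ.≤ eval face x y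
  face-nonneg {x} {y} x∈ = subst (0ℤ ℤ.≤_) (sym (eval-face x y))
    (ℤₚ.+-mono-≤ (ℤₚ.+-mono-≤ (Fλ.face-nonneg x∈) (Fμ.face-nonneg x∈)) (Fd.face-nonneg x∈))

  face-vanishes : ∀ j → eval face (xs j) (ys j) ≡ 0ℤ
  face-vanishes j = trans (eval-face (xs j) (ys j))
    (cong₂ ℤ._+_ (cong₂ ℤ._+_ (Fλ.face-vanishes j) (Fμ.face-vanishes j)) (Fd.face-vanishes j))

  face-zero⇒spanned : ∀ {x y} → Kostka r x y → eval face x y ≡ 0ℤ → InFaceSpannedBy x y xs ys
  face-zero⇒spanned {x} {y} x∈ face≡0 = record
    { λ-drops  = ∀Fin⇒∀< λ p d → map₂ (λ {j} → to (λ-drop≢0⇔ p (xs j) (ys j)))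
                   (Fλ.face-covers x∈ λ-zero p (from (λ-drop≢0⇔ p x y) d))
    ; μ-drops  = ∀Fin⇒∀< λ p d → map₂ (λ {j} → to (μ-drop≢0⇔ p (xs j) (ys j)))
                   (Fμ.face-covers x∈ μ-zero p (from (μ-drop≢0⇔ p x y) d))
    ; excesses = ∀Fin⇒∀< λ p e → map₂ (λ {j} → to (dominance≢0⇔ p (xs j) (ys j)))
                   (Fd.face-covers x∈ d-zero p (from (dominance≢0⇔ p x y) e))
    }
    where
    λμ-zero×d-zero : eval Fλ.face x y ℤ.+ eval Fμ.face x y ≡ 0ℤ × eval Fd.face x y ≡ 0ℤ
    λμ-zero×d-zero = nonneg-+-≡0 (ℤₚ.+-mono-≤ (Fλ.face-nonneg x∈) (Fμ.face-nonneg x∈)) (Fd.face-nonneg x∈)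
                                 (trans (sym (eval-face x y)) face≡0)

    λ-zero×μ-zero : eval Fλ.face x y ≡ 0ℤ × eval Fμ.face x y ≡ 0ℤ
    λ-zero×μ-zero = nonneg-+-≡0 (Fλ.face-nonneg x∈) (Fμ.face-nonneg x∈) (proj₁ λμ-zero×d-zero)

    λ-zero : eval Fλ.face x y ≡ 0ℤ
    λ-zero = proj₁ λ-zero×μ-zero

    μ-zero : eval Fμ.face x y ≡ 0ℤ
    μ-zero = proj₂ λ-zero×μ-zero

    d-zero : eval Fd.face x y ≡ 0ℤ
    d-zero = proj₂ λμ-zero×d-zero

<ᵇ-true : ∀ {m n} → m < n → (m <ᵇ n) ≡ true
<ᵇ-true {m} {n} m<n with m <ᵇ n | ℕₚ.<ᵇ-reflects-< m n
... | true  | _        = refl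
... | false | ofⁿ m≮n = ⊥-elim (m≮n m<n)

<ᵇ-false : ∀ {m n} → n ≤ m → (m <ᵇ n) ≡ false
<ᵇ-false {m} {n} n≤m with m <ᵇ n | ℕₚ.<ᵇ-reflects-< m n
... | false | _       = refl
... | true  | ofʸ m<n = ⊥-elim (ℕₚ.<⇒≱ m<n n≤m)

drop-+ : ∀ {f g : ℕ → ℕ} {n} → DropsAt (λ m → f m + g m) n → DropsAt f n ⊎ DropsAt g n
drop-+ {f} {g} {n} d with f n ℕₚ.≟ f (suc n)
... | yes fn≡ = inj₂ (λ gn≡ → d (cong₂ _+_ fn≡ gn≡))
... | no  fn≢ = inj₁ fn≢

drop-+ˡ : ∀ {f g : ℕ → ℕ} {n} → f n ≡ f (suc n) → DropsAt g n → DropsAt (λ m → f m + g m) n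
drop-+ˡ {f} {g} {n} fn≡ gn≢ sum≡ =
  gn≢ (ℕₚ.+-cancelˡ-≡ (f n) (g n) (g (suc n)) (trans sum≡ (cong (_+ g (suc n)) (sym fn≡))))

drop-+ʳ : ∀ {f g : ℕ → ℕ} {n} → DropsAt f n → g n ≡ g (suc n) → DropsAt (λ m → f m + g m) n
drop-+ʳ {f} {g} {n} fn≢ gn≡ sum≡ =
  fn≢ (ℕₚ.+-cancelʳ-≡ (g n) (f n) (f (suc n)) (trans sum≡ (cong (_+_ (f (suc n))) (sym gn≡))))

DropsAt-cong : ∀ {f g : ℕ → ℕ} → (∀ m → f m ≡ g m) → ∀ n → DropsAt f n ⇔ DropsAt g n
DropsAt-cong f≗g n = mk⇔ (λ d gn≡ → d (trans (f≗g n) (trans gn≡ (sym (f≗g (suc n))))))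
                         (λ d fn≡ → d (trans (sym (f≗g n)) (trans fn≡ (f≗g (suc n)))))

box : ℕ → ℕ → ℕ → ℕ
box h w n = if n <ᵇ w then h else 0

box-< : ∀ {h w n} → n < w → box h w n ≡ h
box-< {h} n<w = cong (λ c → if c then h else 0) (<ᵇ-true n<w)

box-≥ : ∀ {h w n} → w ≤ n → box h w n ≡ 0
box-≥ {h} w≤n = cong (λ c → if c then h else 0) (<ᵇ-false w≤n)

box-antitone : ∀ h w {m n} → m ≤ n → box h w n ≤ box h w m
box-antitone h w {m} {n} m≤n with n ℕₚ.<? w
... | yes n<w = ℕₚ.≤-reflexive (trans (box-< n<w) (sym (box-< (ℕₚ.≤-<-trans m≤n n<w))))
... | no  n≮w = subst (_≤ box h w m) (sym (box-≥ (ℕₚ.≮⇒≥ n≮w))) z≤n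

box-flat : ∀ h w {n} → suc n < w → box h w n ≡ box h w (suc n)
box-flat h w sn<w = trans (box-< (ℕₚ.<-trans (ℕₚ.n<1+n _) sn<w)) (sym (box-< sn<w))

box-drop⇒ : ∀ h w {n} → DropsAt (box h w) n → suc n ≡ w
box-drop⇒ h w {n} d with ℕₚ.<-cmp (suc n) w
... | tri< sn<w _ _    = ⊥-elim (d (box-flat h w sn<w))
... | tri≈ _ sn≡w _    = sn≡w
... | tri> _ _ w<sn    = ⊥-elim (d (trans (box-≥ (ℕₚ.≤-pred w<sn)) (sym (box-≥ (ℕₚ.<⇒≤ w<sn)))))

box-drop⇐ : ∀ {h w n} → 1 ≤ h → suc n ≡ w → DropsAt (box h w) n
box-drop⇐ {h} {w} {n} 1≤h sn≡w box≡ = ℕₚ.<⇒≢ 1≤h (sym (begin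
  h                  ≡⟨ sym (box-< (subst (n <_) sn≡w (ℕₚ.n<1+n n))) ⟩
  box h w n          ≡⟨ box≡ ⟩
  box h w (suc n)    ≡⟨ box-≥ (ℕₚ.≤-reflexive (sym sn≡w)) ⟩
  0                  ∎))
  where open ≡-Reasoning

psum-cong : ∀ {r} {x y : Fin r → ℕ} → (∀ i → x i ≡ y i) → ∀ k → psum x k ≡ psum y k
psum-cong {zero}  x≗y k       = refl
psum-cong {suc r} x≗y zero    = refl
psum-cong {suc r} x≗y (suc k) = cong₂ _+_ (x≗y fzero) (psum-cong (x≗y ∘ fsuc) k)

psum-+ : ∀ {r} (x y : Fin r → ℕ) k → psum (λ i → x i + y i) k ≡ psum x k + psum y k
psum-+ {zero}  x y k       = refl
psum-+ {suc r} x y zero    = refl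
psum-+ {suc r} x y (suc k) = trans (cong (_+_ (x fzero + y fzero)) (psum-+ (x ∘ fsuc) (y ∘ fsuc) k))
                                   (middle-swap (x fzero) (y fzero) (psum (x ∘ fsuc) k) (psum (y ∘ fsuc) k))
  where
  middle-swap : ∀ a b c d → (a + b) + (c + d) ≡ (a + c) + (b + d)
  middle-swap = ℕ-Solver.solve-∀

psum-box : ∀ {r} h w k → k ≤ r → psum {r} (λ i → box h w (toℕ i)) k ≡ h * (k ⊓ w)
psum-box {zero}  h w       zero    _         = sym (ℕₚ.*-zeroʳ h)
psum-box {suc r} h w       zero    _         = sym (ℕₚ.*-zeroʳ h)
psum-box {suc r} h zero    (suc k) (s≤s k≤r) = trans (psum-box h zero k k≤r) (cong (h *_) (ℕₚ.⊓-zeroʳ k))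
psum-box {suc r} h (suc w) (suc k) (s≤s k≤r) = trans (cong (_+_ h) (psum-box h w k k≤r)) (sym (ℕₚ.*-suc h (k ⊓ w)))

m≤m+n+o : ∀ m n o → m ≤ m + n + o
m≤m+n+o m n o = ℕₚ.≤-trans (ℕₚ.m≤m+n m n) (ℕₚ.m≤m+n (m + n) o)

m<m+n⇒0<n : ∀ m {n} → m < m + n → 0 < n
m<m+n⇒0<n m {zero}  m<m+0 = ⊥-elim (ℕₚ.<-irrefl (sym (ℕₚ.+-identityʳ m)) m<m+0)
m<m+n⇒0<n m {suc n} _     = s≤s z≤n

for-positive : ∀ {P : ℕ → Set} → (∀ n → P (suc n)) → ∀ x → 1 ≤ x → P x
for-positive P-suc (suc n) _ = P-suc n

stepλ stepμ : ℕ → ℕ → ℕ → ℕ → ℕ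
stepλ l B C n = box (B + C) (l + B) n
stepμ l B C n = box C l n + box B (l + B + C) n

Σstepλ Σstepμ : ℕ → ℕ → ℕ → ℕ → ℕ
Σstepλ l B C k = (B + C) * (k ⊓ (l + B))
Σstepμ l B C k = C * (k ⊓ l) + B * (k ⊓ (l + B + C))

psum-stepλ : ∀ {r} l B C k → k ≤ r → psum {r} (λ i → stepλ l B C (toℕ i)) k ≡ Σstepλ l B C k
psum-stepλ l B C = psum-box (B + C) (l + B)

psum-stepμ : ∀ {r} l B C k → k ≤ r → psum {r} (λ i → stepμ l B C (toℕ i)) k ≡ Σstepμ l B C k
psum-stepμ {r} l B C k k≤r = trans (psum-+ {r} (λ i → box C l (toℕ i)) (λ i → box B (l + B + C) (toℕ i)) k)
                               (cong₂ _+_ (psum-box C l k k≤r) (psum-box B (l + B + C) k k≤r))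

Σstep-tight : ∀ l B C k → k ≤ l ⊎ l + B + C ≤ k ⊎ C ≡ 0 → Σstepμ l B C k ≡ Σstepλ l B C k
Σstep-tight l B C k (inj₁ k≤l)
  rewrite ℕₚ.m≤n⇒m⊓n≡m k≤l
        | ℕₚ.m≤n⇒m⊓n≡m (ℕₚ.≤-trans k≤l (m≤m+n+o l B C))
        | ℕₚ.m≤n⇒m⊓n≡m (ℕₚ.≤-trans k≤l (ℕₚ.m≤m+n l B)) = below C B k
  where
  below : ∀ C B k → C * k + B * k ≡ (B + C) * k
  below = ℕ-Solver.solve-∀
Σstep-tight l B C k (inj₂ (inj₁ a≤k))
  rewrite ℕₚ.m≥n⇒m⊓n≡n (ℕₚ.≤-trans (m≤m+n+o l B C) a≤k)
        | ℕₚ.m≥n⇒m⊓n≡n a≤k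
        | ℕₚ.m≥n⇒m⊓n≡n (ℕₚ.≤-trans (ℕₚ.m≤m+n (l + B) C) a≤k) = above C B l
  where
  above : ∀ C B l → C * l + B * (l + B + C) ≡ (B + C) * (l + B)
  above = ℕ-Solver.solve-∀
Σstep-tight l B C k (inj₂ (inj₂ refl))
  rewrite ℕₚ.+-identityʳ (l + B) | ℕₚ.+-identityʳ B = refl

-- The slack is C (k ∸ l) while k ≤ l + B, and B (l + B + C ∸ k) afterwards.
Σstep-slack : ∀ l B C k → l ≤ k → k ≤ l + B + C →
  ∃ λ e → Σstepμ l B C k + e ≡ Σstepλ l B C k × (l < k → k < l + B + C → 1 ≤ B → 1 ≤ C → 1 ≤ e)
Σstep-slack l B C k l≤k k≤a with ℕₚ.≤-total k (l + B)
... | inj₁ k≤b with ℕₚ.m≤n⇒∃[o]m+o≡n l≤k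
...   | s , refl = C * s , rising , λ l<k _ _ 1≤C → ℕₚ.*-mono-≤ 1≤C (m<m+n⇒0<n l l<k)
  where
  identity : ∀ C B l s → C * l + B * (l + s) + C * s ≡ (B + C) * (l + s)
  identity = ℕ-Solver.solve-∀
  rising : Σstepμ l B C (l + s) + C * s ≡ Σstepλ l B C (l + s)
  rising rewrite ℕₚ.m≥n⇒m⊓n≡n (ℕₚ.m≤m+n l s)
               | ℕₚ.m≤n⇒m⊓n≡m k≤a
               | ℕₚ.m≤n⇒m⊓n≡m k≤b = identity C B l s
Σstep-slack l B C k l≤k k≤a | inj₂ b≤k with ℕₚ.m≤n⇒∃[o]m+o≡n b≤k
...   | t , refl with ℕₚ.m≤n⇒∃[o]m+o≡n (ℕₚ.+-cancelˡ-≤ (l + B) t C k≤a)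
...     | u , refl = B * u , falling ,
                     λ _ k<a 1≤B _ → ℕₚ.*-mono-≤ 1≤B (m<m+n⇒0<n t (ℕₚ.+-cancelˡ-< (l + B) t (t + u) k<a))
  where
  identity : ∀ t u B l → (t + u) * l + B * (l + B + t) + B * u ≡ (B + (t + u)) * (l + B)
  identity = ℕ-Solver.solve-∀
  falling : Σstepμ l B (t + u) (l + B + t) + B * u ≡ Σstepλ l B (t + u) (l + B + t)
  falling rewrite ℕₚ.m≥n⇒m⊓n≡n l≤k
                | ℕₚ.m≤n⇒m⊓n≡m k≤a
                | ℕₚ.m≥n⇒m⊓n≡n (ℕₚ.m≤m+n (l + B) t) = identity t u B l

Σstep-≤ : ∀ l B C k → Σstepμ l B C k ≤ Σstepλ l B C k
Σstep-≤ l B C k with ℕₚ.≤-total k l | ℕₚ.≤-total k (l + B + C)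
... | inj₁ k≤l | _        = ℕₚ.≤-reflexive (Σstep-tight l B C k (inj₁ k≤l))
... | inj₂ _   | inj₂ a≤k = ℕₚ.≤-reflexive (Σstep-tight l B C k (inj₂ (inj₁ a≤k)))
... | inj₂ l≤k | inj₁ k≤a with Σstep-slack l B C k l≤k k≤a
...   | e , μ+e≡λ , _ = subst (Σstepμ l B C k ≤_) μ+e≡λ (ℕₚ.m≤m+n _ e)

Σstep-< : ∀ l B C k → l < k → k < l + B + C → 1 ≤ B → 1 ≤ C → Σstepμ l B C k < Σstepλ l B C k
Σstep-< l B C k l<k k<a 1≤B 1≤C with Σstep-slack l B C k (ℕₚ.<⇒≤ l<k) (ℕₚ.<⇒≤ k<a)
... | e , μ+e≡λ , 1≤e =
  subst (Σstepμ l B C k <_) μ+e≡λ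
        (subst (_< Σstepμ l B C k + e) (ℕₚ.+-identityʳ _) (ℕₚ.+-monoʳ-< (Σstepμ l B C k) (1≤e l<k k<a 1≤B 1≤C)))

-- Rays of the Kostka cone

≡ᵇ-false : ∀ {m n} → m ≢ n → (m ≡ᵇ n) ≡ false
≡ᵇ-false {m} {n} m≢n with m ≡ᵇ n | ℕₚ.≡ᵇ⇒≡ m n
... | false | _    = refl
... | true  | m≡n = ⊥-elim (m≢n (m≡n _))

≡ᵇ-refl : ∀ m → (m ≡ᵇ m) ≡ true
≡ᵇ-refl m with m ≡ᵇ m | ℕₚ.≡⇒≡ᵇ m m refl
... | true | _ = refl

-- The ray of (l + B + C, l + B, l) is λ = (B + C)^(l + B), μ = ((B + C)^l, B^(B + C));
-- the ray of (a, a, a) is the case l = 0, B = a, C = 0.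
record Shape (r : ℕ) (M : Label) : Set where
  field
    l B C : ℕ
    rayλ≗ : ∀ i → rayλ r M i ≡ stepλ l B C (toℕ i)
    rayμ≗ : ∀ i → rayμ r M i ≡ stepμ l B C (toℕ i)
    1≤B   : 1 ≤ B
    b≡    : l + B ≡ b M
    a≡    : l + B + C ≡ a M
    a≤r   : a M ≤ r
    ℓ≡    : (l ≡ ℓ M × 1 ≤ C) ⊎ (l ≡ 0 × C ≡ 0 × ℓ M ≡ a M)

shape : ∀ {r M} → ValidLabel r M → Shape r M
shape {r} {lab a b ℓ} (inj₁ (ℓ<b , b<a , a≤r)) with ℕₚ.m≤n⇒∃[o]m+o≡n (ℕₚ.<⇒≤ ℓ<b)
... | B , refl with ℕₚ.m≤n⇒∃[o]m+o≡n (ℕₚ.<⇒≤ b<a)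
...   | C , refl = record
  { l = ℓ ; B = B ; C = C
  ; rayλ≗ = λ i → trans (cong-app generic-λ i) (cong (λ h → box h (ℓ + B) (toℕ i)) a∸ℓ≡B+C)
  ; rayμ≗ = λ i → trans (cong-app generic-μ i)
      (trans (cong₂ (λ h h′ → if toℕ i <ᵇ ℓ then h else (if toℕ i <ᵇ ℓ + B + C then h′ else 0))
                    a∸ℓ≡B+C (ℕₚ.m+n∸m≡n ℓ B))
             (two-boxes (toℕ i)))
  ; 1≤B = m<m+n⇒0<n ℓ ℓ<b
  ; b≡ = refl ; a≡ = refl ; a≤r = a≤r
  ; ℓ≡ = inj₁ (refl , m<m+n⇒0<n (ℓ + B) b<a)
  }
  where
  a≢b : ℓ + B + C ≢ ℓ + B
  a≢b = ℕₚ.<⇒≢ b<a ∘ sym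
  generic-λ : rayλ r (lab (ℓ + B + C) (ℓ + B) ℓ) ≡ genλ r (ℓ + B + C) (ℓ + B) ℓ
  generic-λ = cong (λ c → if c then genλ r (ℓ + B + C) (ℓ + B + C) 0 else genλ r (ℓ + B + C) (ℓ + B) ℓ)
                   (≡ᵇ-false a≢b)
  generic-μ : rayμ r (lab (ℓ + B + C) (ℓ + B) ℓ) ≡ genμ r (ℓ + B + C) (ℓ + B) ℓ
  generic-μ = cong (λ c → if c then genμ r (ℓ + B + C) (ℓ + B + C) 0 else genμ r (ℓ + B + C) (ℓ + B) ℓ)
                   (≡ᵇ-false a≢b)
  a∸ℓ≡B+C : ℓ + B + C ∸ ℓ ≡ B + C
  a∸ℓ≡B+C = trans (cong (_∸ ℓ) (ℕₚ.+-assoc ℓ B C)) (ℕₚ.m+n∸m≡n ℓ (B + C))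
  two-boxes : ∀ n → (if n <ᵇ ℓ then B + C else box B (ℓ + B + C) n) ≡ stepμ ℓ B C n
  two-boxes n with n ℕₚ.<? ℓ
  ... | yes n<ℓ = trans (cong (λ c → if c then B + C else box B (ℓ + B + C) n) (<ᵇ-true n<ℓ))
                        (trans (ℕₚ.+-comm B C)
                               (sym (cong₂ _+_ (box-< n<ℓ) (box-< (ℕₚ.<-≤-trans n<ℓ (m≤m+n+o ℓ B C))))))
  ... | no  n≮ℓ = trans (cong (λ c → if c then B + C else box B (ℓ + B + C) n) (<ᵇ-false (ℕₚ.≮⇒≥ n≮ℓ)))
                        (sym (cong (_+ box B (ℓ + B + C) n) (box-≥ (ℕₚ.≮⇒≥ n≮ℓ))))
shape {r} {lab a _ _} (inj₂ (refl , refl , 1≤a , a≤r)) = record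
  { l = 0 ; B = a ; C = 0
  ; rayλ≗ = λ i → trans (cong-app diagonal-λ i) (cong (λ h → box h a (toℕ i)) (sym (ℕₚ.+-identityʳ a)))
  ; rayμ≗ = λ i → trans (cong-app diagonal-μ i) (cong (λ w → box a w (toℕ i)) (sym (ℕₚ.+-identityʳ a)))
  ; 1≤B = 1≤a ; b≡ = refl ; a≡ = ℕₚ.+-identityʳ a ; a≤r = a≤r
  ; ℓ≡ = inj₂ (refl , refl , refl)
  }
  where
  diagonal-λ : rayλ r (lab a a a) ≡ genλ r a a 0
  diagonal-λ = cong (λ c → if c then genλ r a a 0 else genλ r a a a) (≡ᵇ-refl a)
  diagonal-μ : rayμ r (lab a a a) ≡ genμ r a a 0
  diagonal-μ = cong (λ c → if c then genμ r a a 0 else genμ r a a a) (≡ᵇ-refl a)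

Endpoint : ℕ → Label → Set
Endpoint x M = x ≡ ℓ M ⊎ x ≡ a M

Inside : ℕ → Label → Set
Inside k M = ℓ M < k × k < a M

module Ray {r : ℕ} {M : Label} (valid : ValidLabel r M) where
  open Shape (shape valid)

  private
    a′≤r : l + B + C ≤ r
    a′≤r = subst (_≤ r) (sym a≡) a≤r

    b≤r : l + B ≤ r
    b≤r = ℕₚ.≤-trans (ℕₚ.m≤m+n (l + B) C) a′≤r

    l<a′ : l < l + B + C
    l<a′ = ℕₚ.<-≤-trans (ℕₚ.m<m+n l 1≤B) (ℕₚ.m≤m+n (l + B) C)

  entry-rayλ : ∀ n → entry (rayλ r M) n ≡ stepλ l B C n
  entry-rayλ = entry-≗ (stepλ l B C) rayλ≗ (λ n r≤n → box-≥ (ℕₚ.≤-trans b≤r r≤n))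

  entry-rayμ : ∀ n → entry (rayμ r M) n ≡ stepμ l B C n
  entry-rayμ = entry-≗ (stepμ l B C) rayμ≗ λ n r≤n →
    cong₂ _+_ (box-≥ (ℕₚ.≤-trans (m≤m+n+o l B C) (ℕₚ.≤-trans a′≤r r≤n))) (box-≥ (ℕₚ.≤-trans a′≤r r≤n))

  psum-rayλ : ∀ k → k ≤ r → psum (rayλ r M) k ≡ Σstepλ l B C k
  psum-rayλ k k≤r = trans (psum-cong rayλ≗ k) (psum-stepλ l B C k k≤r)

  psum-rayμ : ∀ k → k ≤ r → psum (rayμ r M) k ≡ Σstepμ l B C k
  psum-rayμ k k≤r = trans (psum-cong rayμ≗ k) (psum-stepμ l B C k k≤r)

  ray-kostka : Kostka r (rayλ r M) (rayμ r M)
  ray-kostka =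
    (λ i j i≤j → subst₂ _≤_ (sym (rayλ≗ j)) (sym (rayλ≗ i)) (box-antitone (B + C) (l + B) i≤j)) ,
    (λ i j i≤j → subst₂ _≤_ (sym (rayμ≗ j)) (sym (rayμ≗ i))
                   (ℕₚ.+-mono-≤ (box-antitone C l i≤j) (box-antitone B (l + B + C) i≤j))) ,
    trans (psum-rayλ r ℕₚ.≤-refl)
          (trans (sym (Σstep-tight l B C r (inj₂ (inj₁ a′≤r)))) (sym (psum-rayμ r ℕₚ.≤-refl))) ,
    λ k k≤r → subst₂ _≤_ (sym (psum-rayμ k k≤r)) (sym (psum-rayλ k k≤r)) (Σstep-≤ l B C k)

  raySize-pos : 1 ≤ raySize r M
  raySize-pos = ℕₚ.≤-trans (subst (1 ≤_) (sym (psum-rayλ r ℕₚ.≤-refl)) Σλ-pos)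
                           (ℕₚ.m≤m+n (total (rayλ r M)) (total (rayμ r M)))
    where
    Σλ-pos : 1 ≤ Σstepλ l B C r
    Σλ-pos rewrite ℕₚ.m≥n⇒m⊓n≡n b≤r =
      ℕₚ.*-mono-≤ (ℕₚ.≤-trans 1≤B (ℕₚ.m≤m+n B C)) (ℕₚ.≤-trans 1≤B (ℕₚ.m≤n+m B l))

  private
    dropλ⇔ : ∀ n → Drop (rayλ r M) n ⇔ DropsAt (stepλ l B C) n
    dropλ⇔ = DropsAt-cong entry-rayλ

    dropμ⇔ : ∀ n → Drop (rayμ r M) n ⇔ DropsAt (stepμ l B C) n
    dropμ⇔ = DropsAt-cong entry-rayμ

  drop-rayλ : ∀ n → Drop (rayλ r M) n ⇔ (suc n ≡ b M)
  drop-rayλ n = mk⇔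
    (λ d → trans (box-drop⇒ (B + C) (l + B) (to (dropλ⇔ n) d)) b≡)
    (λ sn≡b → from (dropλ⇔ n)
                (box-drop⇐ (ℕₚ.≤-trans 1≤B (ℕₚ.m≤m+n B C)) (trans sn≡b (sym b≡))))

  drop-rayμ : ∀ n → Drop (rayμ r M) n ⇔ Endpoint (suc n) M
  drop-rayμ n = mk⇔ to′ from′
    where
    to′ : Drop (rayμ r M) n → Endpoint (suc n) M
    to′ d with drop-+ {box C l} {box B (l + B + C)} (to (dropμ⇔ n) d) | ℓ≡
    ... | inj₁ dropC | inj₁ (l≡ℓ , _)    = inj₁ (trans (box-drop⇒ C l dropC) l≡ℓ)
    ... | inj₁ dropC | inj₂ (l≡0 , _)    = ⊥-elim (ℕₚ.1+n≢0 (trans (box-drop⇒ C l dropC) l≡0))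
    ... | inj₂ dropB | _                 = inj₂ (trans (box-drop⇒ B (l + B + C) dropB) a≡)

    from′ : Endpoint (suc n) M → Drop (rayμ r M) n
    from′ (inj₂ sn≡a) = from (dropμ⇔ n)
      (drop-+ˡ {box C l} {box B (l + B + C)} (trans (box-≥ l≤n) (sym (box-≥ (ℕₚ.m≤n⇒m≤1+n l≤n))))
               (box-drop⇐ 1≤B (trans sn≡a (sym a≡))))
      where
      l≤n : l ≤ n
      l≤n = ℕₚ.≤-pred (subst (l <_) (trans a≡ (sym sn≡a)) l<a′)
    from′ (inj₁ sn≡ℓ) with ℓ≡
    ... | inj₂ (_ , _ , ℓ≡a) = from′ (inj₂ (trans sn≡ℓ ℓ≡a))
    ... | inj₁ (l≡ℓ , 1≤C)   = from (dropμ⇔ n)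
      (drop-+ʳ {box C l} {box B (l + B + C)} (box-drop⇐ 1≤C sn≡l)
               (box-flat B (l + B + C) (subst (_< l + B + C) (sym sn≡l) l<a′)))
      where
      sn≡l : suc n ≡ l
      sn≡l = trans sn≡ℓ (sym l≡ℓ)

  excess-ray : ∀ k → k ≤ r → Excess (rayλ r M) (rayμ r M) k ⇔ Inside k M
  excess-ray k k≤r = mk⇔ to′ from′
    where
    Excess⇔Σstep≢ : Excess (rayλ r M) (rayμ r M) k ⇔ (Σstepλ l B C k ≢ Σstepμ l B C k)
    Excess⇔Σstep≢ = subst₂ (λ u v → (u ≢ v) ⇔ (Σstepλ l B C k ≢ Σstepμ l B C k))
                           (sym (psum-rayλ k k≤r)) (sym (psum-rayμ k k≤r)) ⇔-refl

    to′ : Excess (rayλ r M) (rayμ r M) k → Inside k M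
    to′ e with to Excess⇔Σstep≢ e | k ℕₚ.≤? l | l + B + C ℕₚ.≤? k | ℓ≡
    ... | ≢ | yes k≤l | _        | _              = ⊥-elim (≢ (sym (Σstep-tight l B C k (inj₁ k≤l))))
    ... | ≢ | no  _   | yes a≤k  | _              = ⊥-elim (≢ (sym (Σstep-tight l B C k (inj₂ (inj₁ a≤k)))))
    ... | ≢ | no  _   | no  _    | inj₂ (_ , C≡0 , _) = ⊥-elim (≢ (sym (Σstep-tight l B C k (inj₂ (inj₂ C≡0)))))
    ... | _ | no  k≰l | no  a≰k  | inj₁ (l≡ℓ , _) =
      subst (_< k) l≡ℓ (ℕₚ.≰⇒> k≰l) , subst (k <_) a≡ (ℕₚ.≰⇒> a≰k)

    from′ : Inside k M → Excess (rayλ r M) (rayμ r M) k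
    from′ (ℓ<k , k<a) with ℓ≡
    ... | inj₂ (_ , _ , ℓ≡a) = ⊥-elim (ℕₚ.<-asym ℓ<k (subst (k <_) (sym ℓ≡a) k<a))
    ... | inj₁ (l≡ℓ , 1≤C)   = from Excess⇔Σstep≢ (ℕₚ.>⇒≢
      (Σstep-< l B C k (subst (_< k) (sym l≡ℓ) ℓ<k) (subst (k <_) (sym a≡) k<a) 1≤B 1≤C))

-- Labels with disjoint intervals

_∈ᴵ_ : ℕ → Label → Set
x ∈ᴵ M = ℓ M ≤ x × x ≤ a M

label-≡ : ∀ {M N} → a M ≡ a N → b M ≡ b N → ℓ M ≡ ℓ N → M ≡ N
label-≡ {lab _ _ _} {lab _ _ _} refl refl refl = refl

module _ {r : ℕ} {M : Label} where

  ℓ≤b : ValidLabel r M → ℓ M ≤ b M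
  ℓ≤b (inj₁ (ℓ<b , _))     = ℕₚ.<⇒≤ ℓ<b
  ℓ≤b (inj₂ (_ , b≡ℓ , _)) = ℕₚ.≤-reflexive (sym b≡ℓ)

  b≤a : ValidLabel r M → b M ≤ a M
  b≤a (inj₁ (_ , b<a , _)) = ℕₚ.<⇒≤ b<a
  b≤a (inj₂ (a≡b , _))     = ℕₚ.≤-reflexive (sym a≡b)

  a≤r : ValidLabel r M → a M ≤ r
  a≤r (inj₁ (_ , _ , a≤r))     = a≤r
  a≤r (inj₂ (_ , _ , _ , a≤r)) = a≤r

  1≤b : ValidLabel r M → 1 ≤ b M
  1≤b (inj₁ (ℓ<b , _))          = ℕₚ.m<n⇒0<n ℓ<b
  1≤b (inj₂ (a≡b , _ , 1≤a , _)) = subst (1 ≤_) a≡b 1≤a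

  b∈ᴵ : ValidLabel r M → b M ∈ᴵ M
  b∈ᴵ valid = ℓ≤b valid , b≤a valid

  endpoint∈ᴵ : ∀ {x} → ValidLabel r M → Endpoint x M → x ∈ᴵ M
  endpoint∈ᴵ valid (inj₁ refl) = ℕₚ.≤-refl , ℕₚ.≤-trans (ℓ≤b valid) (b≤a valid)
  endpoint∈ᴵ valid (inj₂ refl) = ℕₚ.≤-trans (ℓ≤b valid) (b≤a valid) , ℕₚ.≤-refl

  endpoint-b⇒diagonal : ValidLabel r M → Endpoint (b M) M → a M ≡ b M × ℓ M ≡ b M
  endpoint-b⇒diagonal (inj₁ (ℓ<b , _))   (inj₁ b≡ℓ) = ⊥-elim (ℕₚ.<⇒≢ ℓ<b (sym b≡ℓ))
  endpoint-b⇒diagonal (inj₁ (_ , b<a , _)) (inj₂ b≡a) = ⊥-elim (ℕₚ.<⇒≢ b<a b≡a)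
  endpoint-b⇒diagonal (inj₂ (a≡b , b≡ℓ , _)) _       = a≡b , sym b≡ℓ

IntervalsDisjoint : ∀ {m} → (Fin m → Label) → Set
IntervalsDisjoint L = ∀ i j → i ≢ j → a (L i) < ℓ (L j) ⊎ a (L j) < ℓ (L i)

module DisjointLabels {r m : ℕ} (L : Fin m → Label) (valid : ∀ i → ValidLabel r (L i))
  (disjoint : IntervalsDisjoint L) where

  ∈ᴵ-unique : ∀ {x} i j → x ∈ᴵ L i → x ∈ᴵ L j → i ≡ j
  ∈ᴵ-unique i j (ℓi≤x , x≤ai) (ℓj≤x , x≤aj) with i Data.Fin.≟ j
  ... | yes i≡j = i≡j
  ... | no  i≢j with disjoint i j i≢j
  ...   | inj₁ ai<ℓj = ⊥-elim (ℕₚ.<⇒≱ ai<ℓj (ℕₚ.≤-trans ℓj≤x x≤ai))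
  ...   | inj₂ aj<ℓi = ⊥-elim (ℕₚ.<⇒≱ aj<ℓi (ℕₚ.≤-trans ℓi≤x x≤aj))

  endpoint-owner : ∀ {x} i j → Endpoint x (L j) → x ∈ᴵ L i → Endpoint x (L i)
  endpoint-owner {x} i j e x∈i =
    subst (λ j → Endpoint x (L j)) (∈ᴵ-unique j i (endpoint∈ᴵ (valid j) e) x∈i) e

  top-endpoint-owner : ∀ i j → Endpoint (a (L i)) (L j) → j ≡ i
  top-endpoint-owner i j e =
    ∈ᴵ-unique j i (endpoint∈ᴵ (valid j) e) (endpoint∈ᴵ (valid i) (inj₂ refl))

  private
    shared-endpoint≡a : ∀ {x} i → ℓ (L i) < x → x ≤ a (L i) → ∃ (Endpoint x ∘ L) → x ≡ a (L i)
    shared-endpoint≡a i ℓi<x x≤ai (j , e) with endpoint-owner i j e (ℕₚ.<⇒≤ ℓi<x , x≤ai)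
    ... | inj₁ x≡ℓi = ⊥-elim (ℕₚ.<⇒≢ ℓi<x (sym x≡ℓi))
    ... | inj₂ x≡ai = x≡ai

    shared-endpoint≡ℓ : ∀ {z} i → ℓ (L i) ≤ z → z < a (L i) → (1 ≤ z → ∃ (Endpoint z ∘ L)) → z ≡ ℓ (L i)
    shared-endpoint≡ℓ {zero}  i ℓi≤0 _ _ = sym (ℕₚ.n≤0⇒n≡0 ℓi≤0)
    shared-endpoint≡ℓ {suc z} i ℓi≤z z<ai owned with owned (s≤s z≤n)
    ... | j , e with endpoint-owner i j e (ℓi≤z , ℕₚ.<⇒≤ z<ai)
    ...   | inj₁ z≡ℓi = z≡ℓi
    ...   | inj₂ z≡ai = ⊥-elim (ℕₚ.<⇒≢ z<ai z≡ai)

    a≤a-of-covering : ∀ {M} → (∀ k → Inside k M → ∃ (Inside k ∘ L)) → ∀ i → ℓ M < a (L i) → a M ≤ a (L i)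
    a≤a-of-covering {M} insides i ℓM<ai with a M ℕₚ.≤? a (L i)
    ... | yes aM≤ai = aM≤ai
    ... | no  aM≰ai with insides (a (L i)) (ℓM<ai , ℕₚ.≰⇒> aM≰ai)
    ...   | j , ℓj<ai , ai<aj
            with ∈ᴵ-unique i j (endpoint∈ᴵ (valid i) (inj₂ refl)) (ℕₚ.<⇒≤ ℓj<ai , ℕₚ.<⇒≤ ai<aj)
    ...     | refl = ⊥-elim (ℕₚ.<-irrefl refl ai<aj)

  covered⇒listed : ∀ {M} → ValidLabel r M →
    (∀ y → 1 ≤ y → y ≡ b M → ∃ λ j → y ≡ b (L j)) →
    (∀ x → 1 ≤ x → Endpoint x M → ∃ (Endpoint x ∘ L)) →
    (∀ k → Inside k M → ∃ (Inside k ∘ L)) →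
    ∃ λ i → M ≡ L i
  covered⇒listed {lab x y z} (inj₁ (z<y , y<x , _)) bs endpoints insides = i , label-≡ x≡ai y≡bi z≡ℓi
    where
    z<x : z < x
    z<x = ℕₚ.<-trans z<y y<x
    inside : ∃ (Inside (suc z) ∘ L)
    inside = insides (suc z) (ℕₚ.≤-refl , ℕₚ.≤-<-trans z<y y<x)
    i : Fin m
    i = proj₁ inside
    ℓi≤z : ℓ (L i) ≤ z
    ℓi≤z = ℕₚ.≤-pred (proj₁ (proj₂ inside))
    z<ai : z < a (L i)
    z<ai = ℕₚ.<-trans (ℕₚ.n<1+n z) (proj₂ (proj₂ inside))
    x≤ai : x ≤ a (L i)
    x≤ai = a≤a-of-covering {lab x y z} insides i z<ai
    x≡ai : x ≡ a (L i)
    x≡ai = shared-endpoint≡a i (ℕₚ.≤-<-trans ℓi≤z z<x) x≤ai (endpoints x (ℕₚ.m<n⇒0<n z<x) (inj₂ refl))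
    z≡ℓi : z ≡ ℓ (L i)
    z≡ℓi = shared-endpoint≡ℓ i ℓi≤z z<ai (λ 1≤z → endpoints z 1≤z (inj₁ refl))
    y≡bi : y ≡ b (L i)
    y≡bi with bs y (ℕₚ.m<n⇒0<n z<y) refl
    ... | j , y≡bj = subst (λ j → y ≡ b (L j))
      (∈ᴵ-unique j i (subst (_∈ᴵ L j) (sym y≡bj) (b∈ᴵ (valid j)))
                     (ℕₚ.≤-trans ℓi≤z (ℕₚ.<⇒≤ z<y) , ℕₚ.≤-trans (ℕₚ.<⇒≤ y<x) x≤ai))
      y≡bj
  covered⇒listed {lab x _ _} (inj₂ (refl , refl , 1≤x , _)) bs endpoints _
    with bs x 1≤x refl | endpoints x 1≤x (inj₁ refl)
  ... | j , x≡bj | j′ , e′ with endpoint-b⇒diagonal (valid j)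
                       (subst (λ x → Endpoint x (L j)) x≡bj
                              (endpoint-owner j j′ e′ (subst (_∈ᴵ L j) (sym x≡bj) (b∈ᴵ (valid j)))))
  ...   | aj≡bj , ℓj≡bj = j , label-≡ (trans x≡bj (sym aj≡bj)) x≡bj (trans x≡bj (sym ℓj≡bj))

separated⇒independent : ∀ {m r} (v : Fin m → Fin r → ℕ) (c : Fin m → Fin r → ℤ) →
  (∀ i → c i · v i ≢ 0ℤ) → (∀ i j → j ≢ i → c i · v j ≡ 0ℤ) →
  (t : Fin m → ℤ) → (∀ k → sum (λ j → t j ℤ.* + v j k) ≡ 0ℤ) → ∀ i → t i ≡ 0ℤ
separated⇒independent v c self≢0 others≡0 t relation i =
  i*j≡0⇒j≡0 (c i · v i) (self≢0 i) (begin
    c i · v i ℤ.* t i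
      ≡⟨ ℤₚ.*-comm (c i · v i) (t i) ⟩
    t i ℤ.* (c i · v i)
      ≡⟨ sym (sum-single i others-weighted≡0) ⟩
    sum (λ j → t j ℤ.* (c i · v j))
      ≡⟨ sum-cong (λ j → cong (t j ℤ.*_) (sum-cong (λ k → ℤₚ.*-comm (c i k) (+ v j k)))) ⟩
    sum (λ j → t j ℤ.* sum (λ k → + v j k ℤ.* c i k))
      ≡⟨ sum-swap-weighted t (λ j k → + v j k) (c i) ⟩
    sum (λ k → sum (λ j → t j ℤ.* + v j k) ℤ.* c i k)
      ≡⟨ sum-zero (λ k → cong (ℤ._* c i k) (relation k)) ⟩
    0ℤ
      ∎)
  where
  open ≡-Reasoning
  others-weighted≡0 : ∀ j → j ≢ i → t j ℤ.* (c i · v j) ≡ 0ℤ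
  others-weighted≡0 j j≢i = trans (cong (t j ℤ.*_) (others≡0 i j j≢i)) (ℤₚ.*-zeroʳ (t j))

≡⇒SameVertex : ∀ {r M N} → M ≡ N → SameVertex r M N
≡⇒SameVertex refl = (λ _ → refl) , (λ _ → refl)

module FaceOfDisjointLabels {d r : ℕ} (L : Fin (suc d) → Label) (valid : ∀ i → ValidLabel r (L i))
  (disjoint : IntervalsDisjoint L) where

  open DisjointLabels L valid disjoint
  open KostkaFace (λ j → rayλ r (L j)) (λ j → rayμ r (L j)) public

  spanned⇒listed : ∀ {M} → ValidLabel r M →
    InFaceSpannedBy (rayλ r M) (rayμ r M) (λ j → rayλ r (L j)) (λ j → rayμ r (L j)) → ∃ λ i → M ≡ L i
  spanned⇒listed {M} vM spanned = covered⇒listed vM b-shared endpoints-shared insides-shared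
    where
    open InFaceSpannedBy spanned
    module RM = Ray vM

    below-r : ∀ {x} → x ≤ a M → x ≤ r
    below-r x≤a = ℕₚ.≤-trans x≤a (a≤r vM)

    b-shared : ∀ y → 1 ≤ y → y ≡ b M → ∃ λ j → y ≡ b (L j)
    b-shared = for-positive λ n sn≡b →
      let j , drop = λ-drops n (below-r (subst (_≤ a M) (sym sn≡b) (b≤a vM))) (from (RM.drop-rayλ n) sn≡b)
      in  j , to (Ray.drop-rayλ (valid j) n) drop

    endpoints-shared : ∀ x → 1 ≤ x → Endpoint x M → ∃ (Endpoint x ∘ L)
    endpoints-shared = for-positive λ n e →
      let j , drop = μ-drops n (below-r (proj₂ (endpoint∈ᴵ vM e))) (from (RM.drop-rayμ n) e)
      in  j , to (Ray.drop-rayμ (valid j) n) drop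

    insides-shared : ∀ k → Inside k M → ∃ (Inside k ∘ L)
    insides-shared (suc n) (ℓ<k , k<a) =
      let k≤r = below-r (ℕₚ.<⇒≤ k<a)
          j , excess = excesses n k≤r (from (RM.excess-ray (suc n) k≤r) (ℓ<k , k<a))
      in  j , to (Ray.excess-ray (valid j) (suc n) k≤r) excess

  on-face⇒listed : ∀ M → ValidLabel r M → eval face (rayλ r M) (rayμ r M) ≡ 0ℤ → ∃ (SameVertex r M ∘ L)
  on-face⇒listed M vM face≡0 =
    map₂ ≡⇒SameVertex (spanned⇒listed vM (face-zero⇒spanned {rayλ r M} {rayμ r M} (Ray.ray-kostka vM) face≡0))

  listed⇒on-face : ∀ M → ∃ (SameVertex r M ∘ L) → eval face (rayλ r M) (rayμ r M) ≡ 0ℤ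
  listed⇒on-face M (i , sameλ , sameμ) =
    vanishes-proportional face (raySize r (L i)) (raySize r M) (Ray.raySize-pos (valid i)) sameλ sameμ (face-vanishes i)

  -- The μ-drop at a (L i) separates the ray of L i from the others.
  rays-independent : AffIndep r d L
  rays-independent t _ relationμ =
    separated⇒independent (λ j → rayμ r (L j)) (dropCoeffs ∘ top) self≢0 others≡0 t
      (λ k → trans (sym (Σℤ≡sum (λ j → t j ℤ.* + rayμ r (L j) k))) (relationμ k))
    where
    top : Fin (suc d) → ℕ
    top i = pred (a (L i))

    suc-top : ∀ i → suc (top i) ≡ a (L i)
    suc-top i = ℕₚ.suc-pred (a (L i)) {{>-nonZero (ℕₚ.≤-trans (1≤b (valid i)) (b≤a (valid i)))}}

    self≢0 : ∀ i → dropCoeffs (top i) · rayμ r (L i) ≢ 0ℤ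
    self≢0 i = from (dropCoeffs-·≢0⇔ (top i) (rayμ r (L i)))
                    (from (Ray.drop-rayμ (valid i) (top i)) (inj₂ (suc-top i)))

    others≡0 : ∀ i j → j ≢ i → dropCoeffs (top i) · rayμ r (L j) ≡ 0ℤ
    others≡0 i j j≢i with dropCoeffs (top i) · rayμ r (L j) ℤ.≟ 0ℤ
    ... | yes ≡0 = ≡0
    ... | no  ≢0 = ⊥-elim (j≢i (top-endpoint-owner i j (subst (λ x → Endpoint x (L j)) (suc-top i) endpoint)))
      where
      endpoint : Endpoint (suc (top i)) (L j)
      endpoint = to (Ray.drop-rayμ (valid j) (top i)) (to (dropCoeffs-·≢0⇔ (top i) (rayμ r (L j))) ≢0)

lemma5p4 : (d r : ℕ) → 1 ≤ d → 3 * d + 3 ≤ r →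
    (L : Fin (suc d) → Label) →
    (∀ i → ValidLabel r (L i)) →
    (∀ i j → i ≢ j → (a (L i) < ℓ (L j)) ⊎ (a (L j) < ℓ (L i))) →
    IsVertexSetOfDFace r d L
lemma5p4 d r _ _ L valid disjoint =
  onλ face , onμ face ,
  (λ x y x↓ y↓ x≽y → subst (0ℤ ℤ.≤_) (sym (dot≡eval face x y)) (face-nonneg (x↓ , y↓ , x≽y))) ,
  (λ M vM → on-face⇒listed M vM ∘ trans (sym (dot≡eval face (rayλ r M) (rayμ r M))) ,
            trans (dot≡eval face (rayλ r M) (rayμ r M)) ∘ listed⇒on-face M) ,
  rays-independent
  where open FaceOfDisjointLabels L valid disjoint
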